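{- Let $D,A$ be sets, $v:\mathbb{X}\to\mathsf{R}(D,A)$ a valuation, $T\subseteq D^A$ a finite subset and $t$ a lattice term with $[\![t]\!]_v=(\beta,Y)$. Then $[\![t]\!]_{v_T}$ is of the form $(\beta,Y')$ for some $Y'\subseteq D^A$.
   Context: Lattice terms: $t::=x\mid\top\mid t\wedge t\mid\bot\mid t\vee t$, $x\in\mathbb{X}$. $D^A$ is the set of functions $A\to D$, $\delta(f,g)=\{a\in A\mid f(a)\neq g(a)\}$, $\overline{X}^{\alpha}=\{g\in D^A\mid\exists f\in X,\ \delta(f,g)\subseteq\alpha\}$, and $X$ is $\alpha$-closed if $X=\overline{X}^{\alpha}$. $\mathsf{R}(D,A)$ is the complete lattice of pairs $(\alpha,X)$, $\alpha\subseteq A$, $X\subseteq D^A$ $\alpha$-closed, ordered componentwise; meets are componentwise intersections and $\bigvee_i(\alpha_i,X_i)=(\bigcup\alpha_i,\overline{\bigcup X_i}^{\bigcup\alpha_i})$; top $(A,D^A)$, bottom $(\emptyset,\emptyset)$. For $T\subseteq D^A$ let $\mathrm{int}_T(\alpha,X)=(\alpha,\overline{X\cap T}^{\alpha})$; $\mathsf{R}(D,A)_T$ is the set of pairs $\mathrm{int}_T(\alpha,X)$, $\alpha\subseteq A$, $X\subseteq D^A$; it is a complete lattice with joins computed as in $\mathsf{R}(D,A)$ and meets $\bigwedge^T_i(\alpha_i,X_i)=\mathrm{int}_T(\bigcap_i\alpha_i,\bigcap_iX_i)$. The valuation $v_T:\mathbb{X}\to\mathsf{R}(D,A)_T$ is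 $v_T(x)=\mathrm{int}_T(v(x))$, and $[\![t]\!]_{v_T}$ is the value of $t$ in $\mathsf{R}(D,A)_T$ under $v_T$, $[\![t]\!]_v$ its value in $\mathsf{R}(D,A)$ under $v$. -}

module Defs where

open import Level using (0ℓ)
open import Data.Product using (Σ; ∃; _×_; _,_; proj₁; proj₂)
open import Data.List using (List)
open import Data.List.Relation.Unary.Any using (Any)
open import Relation.Binary.PropositionalEquality using (_≡_; _≢_)
open import Relation.Unary using (Pred; U; ∅; _∩_; _∪_; _≐_)

data Term (𝕏 : Set) : Set where
  var : 𝕏 → Term 𝕏
  top : Term 𝕏
  _∧ₜ_ : Term 𝕏 → Term 𝕏 → Term 𝕏
  bot : Term 𝕏
  _∨ₜ_ : Term 𝕏 → Term 𝕏 → Term 𝕏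

module _ {D A : Set} where

  SubA : Set₁
  SubA = Pred A 0ℓ

  SubF : Set₁
  SubF = Pred (A → D) 0ℓ

  δ⊆ : (A → D) → (A → D) → SubA → Set
  δ⊆ f g α = ∀ a → f a ≢ g a → α a

  closure : SubA → SubF → SubF
  closure α X g = ∃ λ f → X f × δ⊆ f g α

  AlphaClosed : SubA → SubF → Set
  AlphaClosed α X = X ≐ closure α X

  -- Raw pairs (α , X); elements of R(D,A) are the α-closed ones.
  Pair : Set₁
  Pair = SubA × SubF

  InR : Pair → Set
  InR (α , X) = AlphaClosed α X

  _≈P_ : Pair → Pair → Set
  (α , X) ≈P (β , Y) = (α ≐ β) × (X ≐ Y)

  ⊤R : Pair
  ⊤R = (U , U)

  ⊥R : Pair
  ⊥R = (∅ , ∅)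

  _∧R_ : Pair → Pair → Pair
  (α , X) ∧R (β , Y) = (α ∩ β , X ∩ Y)

  _∨R_ : Pair → Pair → Pair
  (α , X) ∨R (β , Y) = (α ∪ β , closure (α ∪ β) (X ∪ Y))

  -- A finite subset T ⊆ D^A, given by a list of its elements;
  -- membership is up to pointwise (extensional) equality of functions.
  _∈T_ : (A → D) → List (A → D) → Set
  g ∈T T = Any (λ f → ∀ a → g a ≡ f a) T

  int : List (A → D) → Pair → Pair
  int T (α , X) = (α , closure α (λ g → X g × (g ∈T T)))

  ⊤T : List (A → D) → Pair
  ⊤T T = int T (U , U)

  ⊥T : Pair
  ⊥T = (∅ , ∅)

  meetT : List (A → D) → Pair → Pair → Pair
  meetT T (α , X) (β , Y) = int T (α ∩ β , X ∩ Y)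

  joinT : Pair → Pair → Pair
  joinT = _∨R_

  ⟦_⟧R : {𝕏 : Set} → Term 𝕏 → (𝕏 → Pair) → Pair
  ⟦ var x ⟧R v = v x
  ⟦ top ⟧R v = ⊤R
  ⟦ s ∧ₜ t ⟧R v = ⟦ s ⟧R v ∧R ⟦ t ⟧R v
  ⟦ bot ⟧R v = ⊥R
  ⟦ s ∨ₜ t ⟧R v = ⟦ s ⟧R v ∨R ⟦ t ⟧R v

  valT : {𝕏 : Set} → List (A → D) → (𝕏 → Pair) → 𝕏 → Pair
  valT T v x = int T (v x)

  ⟦_⟧T : {𝕏 : Set} → Term 𝕏 → List (A → D) → (𝕏 → Pair) → Pair
  ⟦ var x ⟧T T w = w x
  ⟦ top ⟧T T w = ⊤T T
  ⟦ s ∧ₜ t ⟧T T w = meetT T (⟦ s ⟧T T w) (⟦ t ⟧T T w)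
  ⟦ bot ⟧T T w = ⊥T
  ⟦ s ∨ₜ t ⟧T T w = joinT (⟦ s ⟧T T w) (⟦ t ⟧T T w)

module Submission where

open import Defs
open import Data.Product using (∃; _,_; proj₁; proj₂)
open import Data.List using (List)
open import Relation.Binary.PropositionalEquality using (_≡_; refl; sym; cong₂; subst)
open import Relation.Unary using (_∩_; _∪_; _≐_)
open import Relation.Unary.Properties using (≐-refl)

-- Every operation of R(D,A)_T acts on first components exactly as in R(D,A),
-- because int_T leaves α unchanged; so the first component of a term's value
-- only depends on the first components of the valuation. Neither the finiteness
-- of T nor the α-closedness of v(x) plays a role.

proj₁-⟦⟧T≡proj₁-⟦⟧R : {𝕏 D A : Set} (T : List (A → D)) (w v : 𝕏 → Pair {D} {A}) →
  (∀ x → proj₁ (w x) ≡ proj₁ (v x)) →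
  (t : Term 𝕏) → proj₁ (⟦ t ⟧T T w) ≡ proj₁ (⟦ t ⟧R v)
proj₁-⟦⟧T≡proj₁-⟦⟧R T w v w≡v (var x) = w≡v x
proj₁-⟦⟧T≡proj₁-⟦⟧R T w v w≡v top = refl
proj₁-⟦⟧T≡proj₁-⟦⟧R T w v w≡v (s ∧ₜ t) =
  cong₂ _∩_ (proj₁-⟦⟧T≡proj₁-⟦⟧R T w v w≡v s) (proj₁-⟦⟧T≡proj₁-⟦⟧R T w v w≡v t)
proj₁-⟦⟧T≡proj₁-⟦⟧R T w v w≡v bot = refl
proj₁-⟦⟧T≡proj₁-⟦⟧R T w v w≡v (s ∨ₜ t) =
  cong₂ _∪_ (proj₁-⟦⟧T≡proj₁-⟦⟧R T w v w≡v s) (proj₁-⟦⟧T≡proj₁-⟦⟧R T w v w≡v t)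

mainTheorem5 : {𝕏 D A : Set} (v : 𝕏 → Pair {D} {A}) → (∀ x → InR (v x)) →
    (T : List (A → D)) (t : Term 𝕏) (β : SubA {D} {A}) (Y : SubF {D} {A}) →
    ⟦ t ⟧R v ≈P (β , Y) →
    ∃ λ (Y' : SubF {D} {A}) → ⟦ t ⟧T T (valT T v) ≈P (β , Y')
mainTheorem5 v _ T t β Y (α≐β , _) =
  proj₂ (⟦ t ⟧T T (valT T v)) , subst (_≐ β) (sym same-α) α≐β , ≐-refl
  where
  same-α : proj₁ (⟦ t ⟧T T (valT T v)) ≡ proj₁ (⟦ t ⟧R v)
  same-α = proj₁-⟦⟧T≡proj₁-⟦⟧R T (valT T v) v (λ _ → refl) t
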